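{- Let $L$ be a residuated lattice. The following are equivalent: (1) $\mathrm{Soc}(L)$ is an essential filter of $L$; (2) for every filter $F\neq\{1\}$ of $L$, $\mathrm{Soc}(F)\neq\{1\}$; (3) every filter of $L$ different from $\{1\}$ contains a simple filter; (4) the intersection of any non-empty family of essential filters of $L$ is an essential filter of $L$.
   Context: A residuated lattice is an algebra $(L,\wedge,\vee,\odot,\rightarrow,0,1)$ such that $(L,\wedge,\vee,0,1)$ is a bounded lattice, $(L,\odot,1)$ is a commutative monoid, and $x\odot z\le y$ iff $z\le x\rightarrow y$. A filter is a nonempty subset closed under $\odot$ and upward closed. A filter $T$ is simple if $T\neq\{1\}$ and the only filters contained in $T$ are $\{1\}$ and $T$. For a filter $F$, $\mathrm{Soc}(F)$ is the smallest filter containing all simple filters contained in $F$ if there is at least one, and $\{1\}$ otherwise. A filter $H$ is essential in $L$ if for every filter $G$, $H\cap G=\{1\}$ implies $G=\{1\}$. -}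

module Defs where

open import Level using (Level; 0ℓ; _⊔_) renaming (suc to lsuc)
open import Data.Product using (Σ; _×_; _,_; ∃)
open import Data.Empty using (⊥)
open import Data.Unit using (⊤)
open import Data.Sum using (_⊎_)
open import Function.Bundles using (_⇔_)
open import Axiom.ExcludedMiddle using (ExcludedMiddle)
open import Relation.Nullary using (¬_)
open import Relation.Unary using (Pred; _⊆_; _∩_)
open import Relation.Binary.PropositionalEquality using (_≡_)
open import Algebra.Core using (Op₂)
open import Algebra.Structures using (IsCommutativeMonoid)
open import Algebra.Lattice.Structures using (IsLattice)

record ResiduatedLattice : Set₁ where
  infixr 7 _⊙_
  infixr 6 _∧_
  infixr 5 _∨_
  infixr 4 _⇒_
  infix  3 _≤_
  field
    Carrier : Set
    _∧_ _∨_ _⊙_ _⇒_ : Op₂ Carrier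
    0# 1# : Carrier
    isLattice : IsLattice _≡_ _∨_ _∧_
    isCommutativeMonoid : IsCommutativeMonoid _≡_ _⊙_ 1#

  _≤_ : Carrier → Carrier → Set
  x ≤ y = x ∧ y ≡ x

  field
    0-least    : ∀ x → 0# ≤ x
    1-greatest : ∀ x → x ≤ 1#
    residuation₁ : ∀ x y z → x ⊙ z ≤ y → z ≤ x ⇒ y
    residuation₂ : ∀ x y z → z ≤ x ⇒ y → x ⊙ z ≤ y

module _ (L : ResiduatedLattice) where
  open ResiduatedLattice L

  One : Pred Carrier 0ℓ
  One x = x ≡ 1#

  _≐_ : ∀ {ℓ₁ ℓ₂} → Pred Carrier ℓ₁ → Pred Carrier ℓ₂ → Set (ℓ₁ ⊔ ℓ₂)
  A ≐ B = (A ⊆ B) × (B ⊆ A)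

  record IsFilter {ℓ} (F : Pred Carrier ℓ) : Set ℓ where
    field
      nonempty : ∃ λ x → F x
      ⊙-closed : ∀ {x y} → F x → F y → F (x ⊙ y)
      up-closed : ∀ {x y} → x ≤ y → F x → F y

  record IsSimple (T : Pred Carrier 0ℓ) : Set₁ where
    field
      isFilter : IsFilter T
      nontrivial : ¬ (T ≐ One)
      minimal : ∀ (G : Pred Carrier 0ℓ) → IsFilter G → G ⊆ T →
                (G ≐ One) ⊎ (G ≐ T)

  -- Soc(F): the smallest filter containing every simple filter contained in F,
  -- i.e. the intersection of all filters containing those simple filters.
  -- When F contains no simple filter this is the intersection of all filters, i.e. {1}.
  Soc : ∀ {ℓ} → Pred Carrier ℓ → Pred Carrier (lsuc 0ℓ ⊔ ℓ)
  Soc F x = ∀ (G : Pred Carrier 0ℓ) → IsFilter G →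
            (∀ (T : Pred Carrier 0ℓ) → IsSimple T → T ⊆ F → T ⊆ G) → G x

  Whole : Pred Carrier 0ℓ
  Whole _ = ⊤

  IsEssential : ∀ {ℓ} → Pred Carrier ℓ → Set (lsuc 0ℓ ⊔ ℓ)
  IsEssential H = ∀ (G : Pred Carrier 0ℓ) → IsFilter G → (H ∩ G) ≐ One → G ≐ One

  IsEssentialFilter : ∀ {ℓ} → Pred Carrier ℓ → Set (lsuc 0ℓ ⊔ ℓ)
  IsEssentialFilter H = IsFilter H × IsEssential H

  Cond1 : Set₁
  Cond1 = IsEssentialFilter (Soc Whole)

  Cond2 : Set₁
  Cond2 = ∀ (F : Pred Carrier 0ℓ) → IsFilter F → ¬ (F ≐ One) → ¬ (Soc F ≐ One)

  Cond3 : Set₁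
  Cond3 = ∀ (F : Pred Carrier 0ℓ) → IsFilter F → ¬ (F ≐ One) →
          Σ (Pred Carrier 0ℓ) λ T → IsSimple T × (T ⊆ F)

  Cond4 : Set₂
  Cond4 = ∀ (I : Set₁) (H : I → Pred Carrier 0ℓ) → I →
          (∀ i → IsEssentialFilter (H i)) →
          IsEssentialFilter (λ x → ∀ i → H i x)

{-# OPTIONS --safe #-}
-- Everything runs through condition 3. A simple filter T meets a filter F either trivially or in all of T,
-- and filters meeting trivially are orthogonal (t ∨ f = 1, i.e. T ⊆ Fᗮ). Hence under (3) every filter
-- containing all simple filters, such as Soc(L) or an intersection of essential filters, is essential;
-- conversely a filter without simple subfilters has trivial socle and is orthogonal to Soc(L).
-- For 4 ⇒ 3, the intersection of all essential filters is essential, so it contains some x ≠ 1 of F.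
-- As J ∨ Jᗮ is essential for every filter J, such an x splits every filter: x ≥ j ⊙ c with j ∈ J, c ∈ Jᗮ.
-- Since d ⊙ c ≤ x and c ∨ z = 1 force d ≤ z ∨ x, this makes the principal filter ⟨x⟩ satisfy the
-- descending chain condition, and classically a nontrivial filter with that property contains a simple one.
module Submission where

open import Defs
open import Level using (Level; 0ℓ; _⊔_; lift; lower) renaming (suc to lsuc)
open import Axiom.ExcludedMiddle using (ExcludedMiddle)
open import Axiom.DoubleNegationElimination using (DoubleNegationElimination; em⇒dne)
open import Algebra.Bundles using (CommutativeMonoid)
open import Algebra.Structures using (IsCommutativeMonoid)
open import Algebra.Lattice.Bundles using (Lattice)
open import Algebra.Lattice.Structures using (IsLattice)
import Algebra.Lattice.Properties.Lattice as LatticeProperties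
import Algebra.Properties.CommutativeSemigroup as CommutativeSemigroupProperties
import Algebra.Properties.Monoid.Mult as MonoidMult
open import Data.Empty using (⊥-elim)
open import Data.Nat.Base as ℕ using (ℕ; zero; suc; _+_; _≤′_; ≤′-refl; ≤′-step)
open import Data.Nat.GeneralisedArithmetic using (fold)
open import Data.Nat.Properties using (≤⇒≤′; m≤m⊔n; m≤n⊔m)
open import Data.Product using (Σ; ∃; ∃₂; _×_; _,_; proj₁; proj₂)
open import Data.Sum using (_⊎_; inj₁; inj₂)
open import Data.Unit using (tt)
open import Function.Base using (_∘_; id)
open import Function.Bundles using (_⇔_; mk⇔)
open import Relation.Binary.Bundles using (Poset)
import Relation.Binary.Lattice as OrderTheoretic
open import Relation.Binary.PropositionalEquality
  using (_≡_; _≢_; refl; sym; trans; cong; cong₂; isEquivalence; module ≡-Reasoning)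
import Relation.Binary.Reasoning.PartialOrder as ≤-Reasoning
open import Relation.Nullary using (¬_)
open import Relation.Unary using (Pred; _⊆_; _∩_)

module Order (L : ResiduatedLattice) where
  open ResiduatedLattice L
  open IsLattice isLattice using (∧-comm; ∧-absorbs-∨)
  open IsCommutativeMonoid isCommutativeMonoid using (comm; identityʳ; identityˡ)

  lattice : Lattice 0ℓ 0ℓ
  lattice = record { isLattice = isLattice }

  open LatticeProperties lattice public using (∨-idem)
  open LatticeProperties lattice using (∧-idem; ∨-∧-orderTheoreticLattice)
  private
    module Lib = OrderTheoretic.Lattice ∨-∧-orderTheoreticLattice

  -- The stdlib orders a lattice by x ≡ x ∧ y, ResiduatedLattice by x ∧ y ≡ x: hence the `sym`s below.
  ≤-poset : Poset 0ℓ 0ℓ 0ℓ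
  ≤-poset = record
    { Carrier = Carrier
    ; _≈_ = _≡_
    ; _≤_ = _≤_
    ; isPartialOrder = record
      { isPreorder = record
        { isEquivalence = isEquivalence
        ; reflexive = λ { refl → ∧-idem _ }
        ; trans = λ p q → sym (Lib.trans (sym p) (sym q))
        }
      ; antisym = λ {x} {y} p q → trans (sym p) (trans (∧-comm x y) q)
      }
    }

  open Poset ≤-poset public using ()
    renaming (refl to ≤-refl; reflexive to ≤-reflexive; trans to ≤-trans; antisym to ≤-antisym)
  open ≤-Reasoning ≤-poset

  x≤x∨y : ∀ x y → x ≤ x ∨ y
  x≤x∨y = ∧-absorbs-∨

  y≤x∨y : ∀ x y → y ≤ x ∨ y
  y≤x∨y x y = sym (Lib.y≤x∨y x y)

  ∨-least : ∀ {x y z} → x ≤ z → y ≤ z → x ∨ y ≤ z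
  ∨-least p q = sym (Lib.∨-least (sym p) (sym q))

  1≤⇒≡1 : ∀ {x} → 1# ≤ x → x ≡ 1#
  1≤⇒≡1 {x} p = ≤-antisym (1-greatest x) p

  ⊙-monoʳ : ∀ {x y z} → y ≤ z → x ⊙ y ≤ x ⊙ z
  ⊙-monoʳ {x} {y} {z} y≤z = residuation₂ x (x ⊙ z) y (≤-trans y≤z (residuation₁ x (x ⊙ z) z ≤-refl))

  ⊙-monoˡ : ∀ {x y z} → x ≤ y → x ⊙ z ≤ y ⊙ z
  ⊙-monoˡ {x} {y} {z} x≤y = begin
    x ⊙ z  ≡⟨ comm x z ⟩
    z ⊙ x  ≤⟨ ⊙-monoʳ x≤y ⟩
    z ⊙ y  ≡⟨ comm z y ⟩
    y ⊙ z  ∎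

  ⊙-mono : ∀ {x y u v} → x ≤ y → u ≤ v → x ⊙ u ≤ y ⊙ v
  ⊙-mono x≤y u≤v = ≤-trans (⊙-monoˡ x≤y) (⊙-monoʳ u≤v)

  x⊙y≤x : ∀ x y → x ⊙ y ≤ x
  x⊙y≤x x y = begin
    x ⊙ y   ≤⟨ ⊙-monoʳ (1-greatest y) ⟩
    x ⊙ 1#  ≡⟨ identityʳ x ⟩
    x       ∎

  x⊙y≤y : ∀ x y → x ⊙ y ≤ y
  x⊙y≤y x y = ≤-trans (≤-reflexive (comm x y)) (x⊙y≤x y x)

  ⊙∨-least : ∀ {x y z w} → z ⊙ x ≤ w → z ⊙ y ≤ w → z ⊙ (x ∨ y) ≤ w
  ⊙∨-least {x} {y} {z} {w} p q =
    residuation₂ z w (x ∨ y) (∨-least (residuation₁ z w x p) (residuation₁ z w y q))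

  ∨⊙-least : ∀ {x y z w} → x ⊙ z ≤ w → y ⊙ z ≤ w → (x ∨ y) ⊙ z ≤ w
  ∨⊙-least {x} {y} {z} {w} p q = begin
    (x ∨ y) ⊙ z  ≡⟨ comm (x ∨ y) z ⟩
    z ⊙ (x ∨ y)  ≤⟨ ⊙∨-least (≤-trans (≤-reflexive (comm z x)) p) (≤-trans (≤-reflexive (comm z y)) q) ⟩
    w            ∎

  ∨-⊙-≤ : ∀ z x y → (z ∨ x) ⊙ (z ∨ y) ≤ z ∨ x ⊙ y
  ∨-⊙-≤ z x y = ⊙∨-least
    (≤-trans (x⊙y≤y (z ∨ x) z) (x≤x∨y z (x ⊙ y)))
    (∨⊙-least (≤-trans (x⊙y≤x z y) (x≤x∨y z (x ⊙ y))) (y≤x∨y z (x ⊙ y)))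

  ∨≡1-⊙ : ∀ {x y z} → x ∨ y ≡ 1# → x ∨ z ≡ 1# → x ∨ y ⊙ z ≡ 1#
  ∨≡1-⊙ {x} {y} {z} x∨y≡1 x∨z≡1 = 1≤⇒≡1 (begin
    1#                 ≡⟨ identityˡ 1# ⟨
    1# ⊙ 1#            ≡⟨ cong₂ _⊙_ x∨y≡1 x∨z≡1 ⟨
    (x ∨ y) ⊙ (x ∨ z)  ≤⟨ ∨-⊙-≤ x y z ⟩
    x ∨ y ⊙ z          ∎)

  ⊙-commutativeMonoid : CommutativeMonoid 0ℓ 0ℓ
  ⊙-commutativeMonoid = record { isCommutativeMonoid = isCommutativeMonoid }

  open CommutativeMonoid ⊙-commutativeMonoid using (monoid; commutativeSemigroup)
  open CommutativeSemigroupProperties commutativeSemigroup public using (interchange)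
  open MonoidMult monoid using (×-homo-1; ×-homo-+) renaming (_×_ to _·_)

  infixr 8 _^_
  _^_ : Carrier → ℕ → Carrier
  x ^ n = n · x

  ^-identityʳ : ∀ x → x ^ 1 ≡ x
  ^-identityʳ = ×-homo-1

  ^-+ : ∀ x m n → x ^ (m + n) ≡ x ^ m ⊙ x ^ n
  ^-+ = ×-homo-+

  ^-mono : ∀ {x y} n → x ≤ y → x ^ n ≤ y ^ n
  ^-mono zero    x≤y = ≤-refl
  ^-mono (suc n) x≤y = ⊙-mono x≤y (^-mono n x≤y)

  ∨-^-≤ : ∀ z x n → (z ∨ x) ^ n ≤ z ∨ x ^ n
  ∨-^-≤ z x zero    = y≤x∨y z 1#
  ∨-^-≤ z x (suc n) = begin
    (z ∨ x) ⊙ (z ∨ x) ^ n    ≤⟨ ⊙-monoʳ (∨-^-≤ z x n) ⟩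
    (z ∨ x) ⊙ (z ∨ x ^ n)    ≤⟨ ∨-⊙-≤ z x (x ^ n) ⟩
    z ∨ x ⊙ x ^ n            ∎

  ^-absorb : ∀ {x z d c} n → x ^ n ≤ z → d ⊙ c ≤ x → z ∨ c ≡ 1# → d ^ n ≤ z
  ^-absorb {x} {z} {d} {c} n xⁿ≤z d⊙c≤x z∨c≡1 = begin
    d ^ n            ≤⟨ ^-mono n d≤z∨x ⟩
    (z ∨ x) ^ n      ≤⟨ ∨-^-≤ z x n ⟩
    z ∨ x ^ n        ≤⟨ ∨-least ≤-refl xⁿ≤z ⟩
    z                ∎
    where
    d≤z∨x : d ≤ z ∨ x
    d≤z∨x = begin
      d                  ≡⟨ identityʳ d ⟨
      d ⊙ 1#             ≡⟨ cong (d ⊙_) z∨c≡1 ⟨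
      d ⊙ (z ∨ c)        ≤⟨ ⊙-monoˡ (y≤x∨y z d) ⟩
      (z ∨ d) ⊙ (z ∨ c)  ≤⟨ ∨-⊙-≤ z d c ⟩
      z ∨ d ⊙ c          ≤⟨ ∨-least (x≤x∨y z x) (≤-trans d⊙c≤x (y≤x∨y z x)) ⟩
      z ∨ x              ∎

module Filters (L : ResiduatedLattice) where
  open ResiduatedLattice L
  open Order L
  open IsLattice isLattice using (∨-comm; ∨-assoc)
  open IsCommutativeMonoid isCommutativeMonoid using (identityˡ)
  open IsFilter
  open ≡-Reasoning

  private
    variable
      a b : Level
      x : Carrier

  contains-1 : {F : Pred Carrier a} → IsFilter L F → F 1#
  contains-1 F-filter = up-closed F-filter (1-greatest _) (proj₂ (nonempty F-filter))

  One⊆filter : {F : Pred Carrier a} → IsFilter L F → One L ⊆ F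
  One⊆filter F-filter refl = contains-1 F-filter

  ⊆One⇒≐One : {F : Pred Carrier a} → IsFilter L F → F ⊆ One L → _≐_ L F (One L)
  ⊆One⇒≐One F-filter F⊆One = F⊆One , One⊆filter F-filter

  ^-closed : {F : Pred Carrier a} → IsFilter L F → ∀ n → F x → F (x ^ n)
  ^-closed F-filter zero    x∈F = contains-1 F-filter
  ^-closed F-filter (suc n) x∈F = ⊙-closed F-filter x∈F (^-closed F-filter n x∈F)

  One-isFilter : IsFilter L (One L)
  One-isFilter = record
    { nonempty  = 1# , refl
    ; ⊙-closed  = λ { refl refl → identityˡ 1# }
    ; up-closed = λ { 1≤y refl → 1≤⇒≡1 1≤y }
    }

  Whole-isFilter : IsFilter L (Whole L)
  Whole-isFilter = record { nonempty = 1# , tt ; ⊙-closed = λ _ _ → tt ; up-closed = λ _ _ → tt }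

  Whole-isEssentialFilter : IsEssentialFilter L (Whole L)
  Whole-isEssentialFilter = Whole-isFilter , λ G G-filter Whole∩G≐One →
    ⊆One⇒≐One G-filter (λ g∈G → proj₁ Whole∩G≐One (tt , g∈G))

  ∩-isFilter : {A : Pred Carrier a} {B : Pred Carrier b} →
               IsFilter L A → IsFilter L B → IsFilter L (A ∩ B)
  ∩-isFilter A-filter B-filter = record
    { nonempty  = 1# , contains-1 A-filter , contains-1 B-filter
    ; ⊙-closed  = λ (x∈A , x∈B) (y∈A , y∈B) → ⊙-closed A-filter x∈A y∈A , ⊙-closed B-filter x∈B y∈B
    ; up-closed = λ x≤y (x∈A , x∈B) → up-closed A-filter x≤y x∈A , up-closed B-filter x≤y x∈B
    }

  ⋂-isFilter : {I : Set a} {H : I → Pred Carrier b} →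
               (∀ i → IsFilter L (H i)) → IsFilter L (λ x → ∀ i → H i x)
  ⋂-isFilter H-filter = record
    { nonempty  = 1# , λ i → contains-1 (H-filter i)
    ; ⊙-closed  = λ x∈H y∈H i → ⊙-closed (H-filter i) (x∈H i) (y∈H i)
    ; up-closed = λ x≤y x∈H i → up-closed (H-filter i) x≤y (x∈H i)
    }

  ascending-⊆ : {K : ℕ → Pred Carrier a} → (∀ n → K n ⊆ K (suc n)) →
                ∀ {m n} → m ≤′ n → K m ⊆ K n
  ascending-⊆ K-ascending ≤′-refl            x∈Kₘ = x∈Kₘ
  ascending-⊆ K-ascending (≤′-step m≤′n) x∈Kₘ = K-ascending _ (ascending-⊆ K-ascending m≤′n x∈Kₘ)

  ⋃-ascending-isFilter : {K : ℕ → Pred Carrier a} → (∀ n → IsFilter L (K n)) →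
                         (∀ n → K n ⊆ K (suc n)) → IsFilter L (λ x → ∃ λ n → K n x)
  ⋃-ascending-isFilter {K = K} K-filter K-ascending = record
    { nonempty  = 1# , 0 , contains-1 (K-filter 0)
    ; ⊙-closed  = λ (m , x∈Kₘ) (n , y∈Kₙ) → m ℕ.⊔ n ,
        ⊙-closed (K-filter (m ℕ.⊔ n)) (lift-to (m≤m⊔n m n) x∈Kₘ) (lift-to (m≤n⊔m m n) y∈Kₙ)
    ; up-closed = λ x≤y (n , x∈Kₙ) → n , up-closed (K-filter n) x≤y x∈Kₙ
    }
    where
    lift-to : ∀ {m n} → m ℕ.≤ n → K m ⊆ K n
    lift-to m≤n = ascending-⊆ K-ascending (≤⇒≤′ m≤n)

  ⟨_⟩ : Carrier → Pred Carrier 0ℓ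
  ⟨ x ⟩ z = ∃ λ n → x ^ n ≤ z

  ⟨⟩-isFilter : IsFilter L ⟨ x ⟩
  ⟨⟩-isFilter {x} = record
    { nonempty  = 1# , 0 , ≤-refl
    ; ⊙-closed  = λ (m , xᵐ≤y) (n , xⁿ≤z) → m + n , ≤-trans (≤-reflexive (^-+ x m n)) (⊙-mono xᵐ≤y xⁿ≤z)
    ; up-closed = λ y≤z (n , xⁿ≤y) → n , ≤-trans xⁿ≤y y≤z
    }

  ∈⟨_⟩ : ∀ x → ⟨ x ⟩ x
  ∈⟨ x ⟩ = 1 , ≤-reflexive (^-identityʳ x)

  ⟨⟩-least : {F : Pred Carrier a} → IsFilter L F → F x → ⟨ x ⟩ ⊆ F
  ⟨⟩-least F-filter x∈F (n , xⁿ≤z) = up-closed F-filter xⁿ≤z (^-closed F-filter n x∈F)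

  infix 9 _ᗮ
  _ᗮ : Pred Carrier a → Pred Carrier a
  (J ᗮ) c = ∀ j → J j → c ∨ j ≡ 1#

  ᗮ-isFilter : {J : Pred Carrier a} → IsFilter L (J ᗮ)
  ᗮ-isFilter = record
    { nonempty  = 1# , λ j _ → 1≤⇒≡1 (x≤x∨y 1# j)
    ; ⊙-closed  = λ {x} {y} x∈Jᗮ y∈Jᗮ j j∈J → begin
        x ⊙ y ∨ j    ≡⟨ ∨-comm (x ⊙ y) j ⟩
        j ∨ x ⊙ y    ≡⟨ ∨≡1-⊙ (trans (∨-comm j x) (x∈Jᗮ j j∈J)) (trans (∨-comm j y) (y∈Jᗮ j j∈J)) ⟩
        1#           ∎
    ; up-closed = λ {x} {y} x≤y x∈Jᗮ j j∈J →
        up-closed One-isFilter (∨-least (≤-trans x≤y (x≤x∨y y j)) (y≤x∨y y j)) (x∈Jᗮ j j∈J)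
    }

  ᗮ-antitone : {A B : Pred Carrier a} → A ⊆ B → B ᗮ ⊆ A ᗮ
  ᗮ-antitone A⊆B c∈Bᗮ j j∈A = c∈Bᗮ j (A⊆B j∈A)

  ⊆ᗮᗮ : {J : Pred Carrier a} → J ⊆ J ᗮ ᗮ
  ⊆ᗮᗮ {x = z} z∈J c c∈Jᗮ = trans (∨-comm z c) (c∈Jᗮ z z∈J)

  ∩ᗮ⊆One : {J : Pred Carrier a} → J ∩ J ᗮ ⊆ One L
  ∩ᗮ⊆One {x = z} (z∈J , z∈Jᗮ) = trans (sym (∨-idem z)) (z∈Jᗮ z z∈J)

  disjoint⇒⊆ᗮ : {A : Pred Carrier a} {B : Pred Carrier b} →
                IsFilter L A → IsFilter L B → A ∩ B ⊆ One L → B ⊆ A ᗮ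
  disjoint⇒⊆ᗮ A-filter B-filter A∩B⊆One {y} y∈B x x∈A =
    A∩B⊆One (up-closed A-filter (y≤x∨y y x) x∈A , up-closed B-filter (x≤x∨y y x) y∈B)

  ∩ᗮ⊆ᗮ⇒⊆ᗮᗮ : {P A B : Pred Carrier a} → IsFilter L P → A ⊆ P → P ∩ B ᗮ ⊆ A ᗮ → A ⊆ B ᗮ ᗮ
  ∩ᗮ⊆ᗮ⇒⊆ᗮᗮ {P = P} {B = B} P-filter A⊆P P∩Bᗮ⊆Aᗮ {z} z∈A c c∈Bᗮ = begin
    z ∨ c          ≡⟨ ∨-comm z c ⟩
    c ∨ z          ≡⟨ cong (c ∨_) (∨-idem z) ⟨
    c ∨ (z ∨ z)    ≡⟨ ∨-assoc c z z ⟨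
    (c ∨ z) ∨ z    ≡⟨ P∩Bᗮ⊆Aᗮ c∨z∈P∩Bᗮ z z∈A ⟩
    1#             ∎
    where
    c∨z∈P∩Bᗮ : (P ∩ B ᗮ) (c ∨ z)
    c∨z∈P∩Bᗮ = up-closed P-filter (y≤x∨y c z) (A⊆P z∈A) , up-closed ᗮ-isFilter (x≤x∨y c z) c∈Bᗮ

  infixr 6 _∨ᶠ_
  _∨ᶠ_ : Pred Carrier a → Pred Carrier b → Pred Carrier (a ⊔ b)
  (A ∨ᶠ B) z = ∃₂ λ x y → A x × B y × x ⊙ y ≤ z

  ∨ᶠ-isFilter : {A : Pred Carrier a} {B : Pred Carrier b} →
                IsFilter L A → IsFilter L B → IsFilter L (A ∨ᶠ B)
  ∨ᶠ-isFilter A-filter B-filter = record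
    { nonempty  = 1# , 1# , 1# , contains-1 A-filter , contains-1 B-filter , 1-greatest _
    ; ⊙-closed  = λ (x , y , x∈A , y∈B , x⊙y≤z) (x′ , y′ , x′∈A , y′∈B , x′⊙y′≤z′) →
        x ⊙ x′ , y ⊙ y′ , ⊙-closed A-filter x∈A x′∈A , ⊙-closed B-filter y∈B y′∈B ,
        ≤-trans (≤-reflexive (interchange x x′ y y′)) (⊙-mono x⊙y≤z x′⊙y′≤z′)
    ; up-closed = λ z≤z′ (x , y , x∈A , y∈B , x⊙y≤z) → x , y , x∈A , y∈B , ≤-trans x⊙y≤z z≤z′
    }

  ⊆∨ᶠˡ : {A : Pred Carrier a} {B : Pred Carrier b} → IsFilter L B → A ⊆ A ∨ᶠ B
  ⊆∨ᶠˡ B-filter {x} x∈A = x , 1# , x∈A , contains-1 B-filter , x⊙y≤x x 1#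

  ⊆∨ᶠʳ : {A : Pred Carrier a} {B : Pred Carrier b} → IsFilter L A → B ⊆ A ∨ᶠ B
  ⊆∨ᶠʳ A-filter {y} y∈B = 1# , y , contains-1 A-filter , y∈B , x⊙y≤y 1# y

  ∨ᶠᗮ-isEssentialFilter : {J : Pred Carrier a} → IsFilter L J → IsEssentialFilter L (J ∨ᶠ J ᗮ)
  ∨ᶠᗮ-isEssentialFilter {J = J} J-filter = ∨ᶠ-isFilter J-filter ᗮ-isFilter , essential
    where
    essential : IsEssential L (J ∨ᶠ J ᗮ)
    essential G G-filter (J∨ᶠJᗮ∩G⊆One , _) = ⊆One⇒≐One G-filter λ g∈G →
      J∨ᶠJᗮ∩G⊆One (⊆∨ᶠʳ J-filter (G⊆Jᗮ g∈G) , g∈G)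
      where
      G⊆Jᗮ : G ⊆ J ᗮ
      G⊆Jᗮ = disjoint⇒⊆ᗮ J-filter G-filter λ (j∈J , j∈G) → J∨ᶠJᗮ∩G⊆One (⊆∨ᶠˡ ᗮ-isFilter j∈J , j∈G)

  ∨ᶠ-absorb : {A : Pred Carrier a} {B : Pred Carrier b} → IsFilter L A → (A ∨ᶠ B) x → ⟨ x ⟩ ∩ B ᗮ ⊆ A
  ∨ᶠ-absorb A-filter (d , c , d∈A , c∈B , d⊙c≤x) ((n , xⁿ≤z) , z∈Bᗮ) =
    up-closed A-filter (^-absorb n xⁿ≤z d⊙c≤x (z∈Bᗮ c c∈B)) (^-closed A-filter n d∈A)

  HasSimple : Pred Carrier 0ℓ → Set₁
  HasSimple F = Σ (Pred Carrier 0ℓ) λ T → IsSimple L T × T ⊆ F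

  Soc-isFilter : {F : Pred Carrier a} → IsFilter L (Soc L F)
  Soc-isFilter = record
    { nonempty  = 1# , λ G G-filter _ → contains-1 G-filter
    ; ⊙-closed  = λ x∈Soc y∈Soc G G-filter cover → ⊙-closed G-filter (x∈Soc G G-filter cover) (y∈Soc G G-filter cover)
    ; up-closed = λ x≤y x∈Soc G G-filter cover → up-closed G-filter x≤y (x∈Soc G G-filter cover)
    }

  Soc-least : {F : Pred Carrier a} {G : Pred Carrier 0ℓ} → IsFilter L G →
              (∀ T → IsSimple L T → T ⊆ F → T ⊆ G) → Soc L F ⊆ G
  Soc-least {G = G} G-filter cover x∈Soc = x∈Soc G G-filter cover

  simple⊆Soc : {F : Pred Carrier a} {T : Pred Carrier 0ℓ} → IsSimple L T → T ⊆ F → T ⊆ Soc L F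
  simple⊆Soc {T = T} T-simple T⊆F x∈T G G-filter cover = cover T T-simple T⊆F x∈T

  simple-free⇒Soc⊆One : {F : Pred Carrier 0ℓ} → ¬ HasSimple F → Soc L F ⊆ One L
  simple-free⇒Soc⊆One no-simple = Soc-least One-isFilter λ T T-simple T⊆F → ⊥-elim (no-simple (T , T-simple , T⊆F))

  simple-nontrivial : {T : Pred Carrier 0ℓ} → IsSimple L T → ¬ T ⊆ One L
  simple-nontrivial T-simple T⊆One =
    IsSimple.nontrivial T-simple (⊆One⇒≐One (IsSimple.isFilter T-simple) T⊆One)

  simple⊆⊎disjoint : {F T : Pred Carrier 0ℓ} → IsSimple L T → IsFilter L F → T ⊆ F ⊎ F ∩ T ⊆ One L
  simple⊆⊎disjoint {F} {T} T-simple F-filter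
    with IsSimple.minimal T-simple (F ∩ T) (∩-isFilter F-filter (IsSimple.isFilter T-simple)) proj₂
  ... | inj₁ (F∩T⊆One , _) = inj₂ F∩T⊆One
  ... | inj₂ (_ , T⊆F∩T)   = inj₁ (proj₁ ∘ T⊆F∩T)

  simple⊆essential : {H T : Pred Carrier 0ℓ} → IsEssentialFilter L H → IsSimple L T → T ⊆ H
  simple⊆essential {T = T} (H-filter , H-essential) T-simple with simple⊆⊎disjoint T-simple H-filter
  ... | inj₁ T⊆H     = T⊆H
  ... | inj₂ H∩T⊆One = ⊥-elim (IsSimple.nontrivial T-simple
                                (H-essential _ T-filter (⊆One⇒≐One (∩-isFilter H-filter T-filter) H∩T⊆One)))
    where
    T-filter : IsFilter L T
    T-filter = IsSimple.isFilter T-simple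

  simple-free⇒Soc∩⊆One : {F : Pred Carrier 0ℓ} → IsFilter L F → ¬ HasSimple F → Soc L (Whole L) ∩ F ⊆ One L
  simple-free⇒Soc∩⊆One {F} F-filter no-simple (z∈Soc , z∈F) = ∩ᗮ⊆One (z∈F , Soc⊆Fᗮ z∈Soc)
    where
    simple⊆Fᗮ : ∀ T → IsSimple L T → T ⊆ Whole L → T ⊆ F ᗮ
    simple⊆Fᗮ T T-simple _ with simple⊆⊎disjoint T-simple F-filter
    ... | inj₁ T⊆F     = ⊥-elim (no-simple (T , T-simple , T⊆F))
    ... | inj₂ F∩T⊆One = disjoint⇒⊆ᗮ F-filter (IsSimple.isFilter T-simple) F∩T⊆One
    Soc⊆Fᗮ : Soc L (Whole L) ⊆ F ᗮ
    Soc⊆Fᗮ = Soc-least ᗮ-isFilter simple⊆Fᗮ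

  Splits : Carrier → Set₁
  Splits x = ∀ J → IsFilter L J → (J ∨ᶠ J ᗮ) x

  -- The filters Kₙ = ⟨x⟩ ∩ Dₙᗮ ascend. Splitting x along their union shows Kₙ₊₁ ⊆ Kₙ for some n,
  -- which puts Dₙ inside ⟨x⟩ ∩ Dₙ₊₁ᗮᗮ; splitting x along Dₙ₊₁ then gives Dₙ ⊆ Dₙ₊₁.
  Splits⇒descending-stalls : Splits x → (D : ℕ → Pred Carrier 0ℓ) → (∀ n → IsFilter L (D n)) →
                             (∀ n → D (suc n) ⊆ D n) → (∀ n → D n ⊆ ⟨ x ⟩) → ∃ λ n → D n ⊆ D (suc n)
  Splits⇒descending-stalls {x} splits D D-filter D-descending D⊆⟨x⟩ =
    let n , Kₙ₊₁⊆Kₙ = K-stalls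
        Dₙ⊆Dₙ₊₁ᗮᗮ = ∩ᗮ⊆ᗮ⇒⊆ᗮᗮ ⟨⟩-isFilter (D⊆⟨x⟩ n) (proj₂ ∘ Kₙ₊₁⊆Kₙ)
    in n , λ z∈Dₙ → ∨ᶠ-absorb (D-filter (suc n)) (splits (D (suc n)) (D-filter (suc n)))
                              (D⊆⟨x⟩ n z∈Dₙ , Dₙ⊆Dₙ₊₁ᗮᗮ z∈Dₙ)
    where
    K : ℕ → Pred Carrier 0ℓ
    K n = ⟨ x ⟩ ∩ D n ᗮ

    K-filter : ∀ n → IsFilter L (K n)
    K-filter n = ∩-isFilter ⟨⟩-isFilter ᗮ-isFilter

    K-ascending : ∀ n → K n ⊆ K (suc n)
    K-ascending n (z∈⟨x⟩ , z∈Dₙᗮ) = z∈⟨x⟩ , ᗮ-antitone (D-descending n) z∈Dₙᗮ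

    K-stalls : ∃ λ n → K (suc n) ⊆ K n
    K-stalls with splits (λ z → ∃ λ n → K n z) (⋃-ascending-isFilter K-filter K-ascending)
    ... | k , c , (n , k∈Kₙ) , c∈⋃Kᗮ , k⊙c≤x = n , λ z∈Kₙ₊₁ →
      ∨ᶠ-absorb (K-filter n) (k , c , k∈Kₙ , c∈⋃Kᗮ , k⊙c≤x) (proj₁ z∈Kₙ₊₁ , ⊆ᗮᗮ (suc n , z∈Kₙ₊₁))

  EssentialFilter : Set₁
  EssentialFilter = Σ (Pred Carrier 0ℓ) (IsEssentialFilter L)

  ∈⋂essential⇒Splits : (∀ (H : EssentialFilter) → proj₁ H x) → Splits x
  ∈⋂essential⇒Splits x∈⋂ J J-filter = x∈⋂ (J ∨ᶠ J ᗮ , ∨ᶠᗮ-isEssentialFilter J-filter)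

  Cond3⇒Cond2 : Cond3 L → Cond2 L
  Cond3⇒Cond2 cond3 F F-filter F-nontrivial (Soc⊆One , _) =
    let T , T-simple , T⊆F = cond3 F F-filter F-nontrivial
    in simple-nontrivial T-simple (Soc⊆One ∘ simple⊆Soc T-simple T⊆F)

module Classical (em : ExcludedMiddle (lsuc 0ℓ)) (L : ResiduatedLattice) where
  open ResiduatedLattice L
  open Filters L

  private
    variable
      a : Level

  dne : DoubleNegationElimination (lsuc 0ℓ)
  dne = em⇒dne em

  dne₀ : {P : Set} → ¬ ¬ P → P
  dne₀ ¬¬p = lower (dne λ ¬p↑ → ¬¬p (¬p↑ ∘ lift))

  ¬⊆One⇒∃≢1 : {A : Pred Carrier (lsuc 0ℓ)} → ¬ A ⊆ One L → ∃ λ x → A x × x ≢ 1#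
  ¬⊆One⇒∃≢1 ¬A⊆One = dne λ no-witness → ¬A⊆One λ {x} x∈A → dne₀ λ x≢1 → no-witness (x , x∈A , x≢1)

  ProperSubfilter : Pred Carrier 0ℓ → Set₁
  ProperSubfilter D = Σ (Pred Carrier 0ℓ) λ G → IsFilter L G × G ⊆ D × ¬ G ⊆ One L × ¬ D ⊆ G

  nonsimple⇒ProperSubfilter : {D : Pred Carrier 0ℓ} → IsFilter L D → ¬ D ⊆ One L → ¬ IsSimple L D →
                              ProperSubfilter D
  nonsimple⇒ProperSubfilter {D} D-filter D-nontrivial D-nonsimple = dne λ no-proper → D-nonsimple record
    { isFilter = D-filter ; nontrivial = D-nontrivial ∘ proj₁ ; minimal = minimal no-proper }
    where
    minimal : ¬ ProperSubfilter D → ∀ G → IsFilter L G → G ⊆ D → _≐_ L G (One L) ⊎ _≐_ L G D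
    minimal no-proper G G-filter G⊆D = dne₀ λ (neither : ¬ (_≐_ L G (One L) ⊎ _≐_ L G D)) →
      no-proper (G , G-filter , G⊆D , neither ∘ inj₁ ∘ ⊆One⇒≐One G-filter , λ D⊆G → neither (inj₂ (G⊆D , D⊆G)))

  record NontrivialSubfilter (F : Pred Carrier 0ℓ) : Set₁ where
    field
      carrier    : Pred Carrier 0ℓ
      isFilter   : IsFilter L carrier
      ⊆F         : carrier ⊆ F
      nontrivial : ¬ carrier ⊆ One L

  open NontrivialSubfilter

  module _ {F : Pred Carrier 0ℓ} (no-simple : ¬ HasSimple F) where

    proper-subfilter : (D : NontrivialSubfilter F) → ProperSubfilter (carrier D)
    proper-subfilter D = nonsimple⇒ProperSubfilter (isFilter D) (nontrivial D)
                                                     λ D-simple → no-simple (carrier D , D-simple , ⊆F D)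

    shrink : NontrivialSubfilter F → NontrivialSubfilter F
    shrink D = let G , G-filter , G⊆D , G-nontrivial , _ = proper-subfilter D in record
      { carrier = G ; isFilter = G-filter ; ⊆F = ⊆F D ∘ G⊆D ; nontrivial = G-nontrivial }

    shrink-⊆ : ∀ D → carrier (shrink D) ⊆ carrier D
    shrink-⊆ D = proj₁ (proj₂ (proj₂ (proper-subfilter D)))

    shrink-proper : ∀ D → ¬ carrier D ⊆ carrier (shrink D)
    shrink-proper D = proj₂ (proj₂ (proj₂ (proj₂ (proper-subfilter D))))

  Splits⇒HasSimple⟨⟩ : ∀ {x} → Splits x → x ≢ 1# → HasSimple ⟨ x ⟩
  Splits⇒HasSimple⟨⟩ {x} splits x≢1 = dne λ no-simple →
    let chain = fold ⟨x⟩-subfilter (shrink no-simple)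
        n , chainₙ⊆chainₙ₊₁ = Splits⇒descending-stalls splits (carrier ∘ chain) (isFilter ∘ chain)
                                                         (shrink-⊆ no-simple ∘ chain) (⊆F ∘ chain)
    in shrink-proper no-simple (chain n) chainₙ⊆chainₙ₊₁
    where
    ⟨x⟩-subfilter : NontrivialSubfilter ⟨ x ⟩
    ⟨x⟩-subfilter = record
      { carrier = ⟨ x ⟩ ; isFilter = ⟨⟩-isFilter ; ⊆F = id ; nontrivial = λ ⟨x⟩⊆One → x≢1 (⟨x⟩⊆One ∈⟨ x ⟩) }

  simples⊆⇒essential : Cond3 L → {H : Pred Carrier a} → (∀ T → IsSimple L T → T ⊆ H) → IsEssential L H
  simples⊆⇒essential cond3 simples⊆H G G-filter (H∩G⊆One , _) = ⊆One⇒≐One G-filter (dne₀ λ G⊈One →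
    let T , T-simple , T⊆G = cond3 G G-filter (G⊈One ∘ proj₁)
    in simple-nontrivial T-simple λ t∈T → H∩G⊆One (simples⊆H T T-simple t∈T , T⊆G t∈T))

  Cond1⇒Cond3 : Cond1 L → Cond3 L
  Cond1⇒Cond3 (_ , Soc-essential) F F-filter F-nontrivial = dne λ no-simple →
    F-nontrivial (Soc-essential F F-filter
      (⊆One⇒≐One (∩-isFilter Soc-isFilter F-filter) (simple-free⇒Soc∩⊆One F-filter no-simple)))

  Cond2⇒Cond3 : Cond2 L → Cond3 L
  Cond2⇒Cond3 cond2 F F-filter F-nontrivial = dne λ no-simple →
    cond2 F F-filter F-nontrivial (⊆One⇒≐One Soc-isFilter (simple-free⇒Soc⊆One no-simple))

  Cond3⇒Cond1 : Cond3 L → Cond1 L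
  Cond3⇒Cond1 cond3 = Soc-isFilter , simples⊆⇒essential cond3 λ T T-simple → simple⊆Soc T-simple _

  Cond3⇒Cond4 : Cond3 L → Cond4 L
  Cond3⇒Cond4 cond3 I H _ H-essential = ⋂-isFilter (proj₁ ∘ H-essential) ,
    simples⊆⇒essential cond3 λ T T-simple t∈T i → simple⊆essential (H-essential i) T-simple t∈T

  Cond4⇒Cond3 : Cond4 L → Cond3 L
  Cond4⇒Cond3 cond4 F F-filter F-nontrivial =
    let x , (x∈E , x∈F) , x≢1 = ¬⊆One⇒∃≢1 E∩F-nontrivial
        T , T-simple , T⊆⟨x⟩ = Splits⇒HasSimple⟨⟩ (∈⋂essential⇒Splits x∈E) x≢1
    in T , T-simple , ⟨⟩-least F-filter x∈F ∘ T⊆⟨x⟩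
    where
    E : Pred Carrier (lsuc 0ℓ)
    E x = ∀ (H : EssentialFilter) → proj₁ H x

    E-essential : IsEssentialFilter L E
    E-essential = cond4 EssentialFilter proj₁ (Whole L , Whole-isEssentialFilter) proj₂

    E∩F-nontrivial : ¬ (E ∩ F) ⊆ One L
    E∩F-nontrivial E∩F⊆One = F-nontrivial
      (proj₂ E-essential F F-filter (⊆One⇒≐One (∩-isFilter (proj₁ E-essential) F-filter) E∩F⊆One))

theorem4p6 : ExcludedMiddle (lsuc 0ℓ) → (L : ResiduatedLattice) →
    (Cond1 L ⇔ Cond2 L) × (Cond1 L ⇔ Cond3 L) × (Cond1 L ⇔ Cond4 L)
theorem4p6 em L =
    mk⇔ (Cond3⇒Cond2 ∘ Cond1⇒Cond3) (Cond3⇒Cond1 ∘ Cond2⇒Cond3)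
  , mk⇔ Cond1⇒Cond3 Cond3⇒Cond1
  , mk⇔ (Cond3⇒Cond4 ∘ Cond1⇒Cond3) (Cond3⇒Cond1 ∘ Cond4⇒Cond3)
  where
  open Filters L
  open Classical em L
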